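{- Let $G$ be a group with identity $e$ and let $L$ be a complete Heyting algebra. On $L^G$ (functions $G\to L$) with pointwise Heyting algebra operations (in particular pointwise pseudocomplement $\neg$), define $(\alpha;\beta)(z)=\bigvee\{\alpha(x)\wedge\beta(y):xy=z\}$, $\alpha^\smile(x)=\alpha(x^{ -1})$, and $1'$ by $1'(e)=1$, $1'(x)=0$ for $x\neq e$. Then $L^G$ satisfies, for all $a,b,c$: (1) $a;(b;c)=(a;b);c$; (2) $a;1'=a=1';a$; (3) $(a\vee b);c=(a;c)\vee(b;c)$ and $a;(b\vee c)=(a;b)\vee(a;c)$; (4) $(a^\smile)^\smile=a$; (5) $(a\vee b)^\smile=a^\smile\vee b^\smile$; (6) $(a;b)^\smile=b^\smile;a^\smile$; (7) $(a^\smile;\neg(a;b))\vee\neg b=\neg b$; and (8$'$) $a;b\le\neg\neg c\iff a^\smile;\neg c\le\neg b\iff\neg c;b^\smile\le\neg a$. Moreover, $L^G$ satisfies $a;b\le c\iff a^\smile;\neg c\le\neg b\iff\neg c;b^\smile\le\neg a$ for all $a,b,c$ if and only if $L$ is a Boolean algebra. -}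

module Defs where

open import Level using (Level; _⊔_; suc; Lift)
open import Data.Product using (Σ; _×_; _,_)
open import Algebra.Bundles using (Group)
open import Relation.Binary.Lattice.Bundles using (HeytingAlgebra)

record CompleteHeytingAlgebra (c ℓ₁ ℓ₂ ι : Level) : Set (suc (c ⊔ ℓ₁ ⊔ ℓ₂ ⊔ ι)) where
  field
    heytingAlgebra : HeytingAlgebra c ℓ₁ ℓ₂
  open HeytingAlgebra heytingAlgebra public
  field
    ⋁       : {I : Set ι} → (I → Carrier) → Carrier
    ⋁-upper : {I : Set ι} (f : I → Carrier) (i : I) → f i ≤ ⋁ f
    ⋁-least : {I : Set ι} (f : I → Carrier) (x : Carrier) → (∀ i → f i ≤ x) → ⋁ f ≤ x

  ¬_ : Carrier → Carrier
  ¬ x = x ⇨ ⊥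

IsBoolean : ∀ {c ℓ₁ ℓ₂ ι} → CompleteHeytingAlgebra c ℓ₁ ℓ₂ ι → Set (c ⊔ ℓ₁)
IsBoolean L = ∀ x → (x ∨ (¬ x)) ≈ ⊤
  where open CompleteHeytingAlgebra L

module FunctionAlgebra {g gℓ c ℓ₁ ℓ₂ : Level}
  (G : Group g gℓ) (L : CompleteHeytingAlgebra c ℓ₁ ℓ₂ (g ⊔ gℓ)) where

  private
    module G = Group G
    module L = CompleteHeytingAlgebra L

  Fn : Set (g ⊔ c)
  Fn = G.Carrier → L.Carrier

  Respects : Fn → Set (g ⊔ gℓ ⊔ ℓ₁)
  Respects α = ∀ {x y} → x G.≈ y → α x L.≈ α y

  infix 4 _≐_ _⊑_
  _≐_ : Fn → Fn → Set (g ⊔ ℓ₁)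
  α ≐ β = ∀ x → α x L.≈ β x

  _⊑_ : Fn → Fn → Set (g ⊔ ℓ₂)
  α ⊑ β = ∀ x → α x L.≤ β x

  infixr 6 _∨ᶠ_
  _∨ᶠ_ : Fn → Fn → Fn
  (α ∨ᶠ β) x = α x L.∨ β x

  ¬ᶠ_ : Fn → Fn
  (¬ᶠ α) x = L.¬ (α x)

  infixr 7 _⨾_
  _⨾_ : Fn → Fn → Fn
  (α ⨾ β) z = L.⋁ {I = Σ (G.Carrier × G.Carrier) (λ { (x , y) → (x G.∙ y) G.≈ z })}
                  (λ { ((x , y) , _) → α x L.∧ β y })

  _⌣ : Fn → Fn
  (α ⌣) x = α (x G.⁻¹)

  -- identity element 1': the characteristic function of {e},
  -- 1'(x) = ⋁ { 1 : x = e }  (= 1 if x = e, = 0 otherwise)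
  1′ : Fn
  1′ x = L.⋁ {I = Lift g (x G.≈ G.ε)} (λ _ → L.⊤)

-- (α ⨾ β) z is the join of α x ∧ β y over the triangles x ∙ y ≈ z, so α ⨾ β ⊑ ¬ γ says
-- that α x ∧ β y ∧ γ z = ⊥ on every triangle. The substitutions (x , y , z) ↦ (x⁻¹ , z , y)
-- and (x , y , z) ↦ (z , y⁻¹ , x) map triangles to triangles, which gives the cycle law
-- for an arbitrary γ: (8′) is the case γ = ¬ c and (7) the case γ = ¬ (a ⨾ b).
-- Replacing ¬ ¬ c by c is harmless exactly when ¬ ¬ c = c; conversely, evaluating the
-- Boolean cycle law at constant functions forces ¬ ¬ x ≤ x in L.
module Submission where

open import Defs
open import Level using (_⊔_; lift)
open import Data.Product using (_×_; _,_; proj₁; proj₂)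
open import Function.Base using (_∘_; const)
open import Function.Bundles using (_⇔_; mk⇔; Equivalence)
open import Function.Construct.Composition using (_⇔-∘_)
open import Function.Construct.Symmetry using (⇔-sym)
open import Algebra.Bundles using (Group)
open import Relation.Binary.Lattice.Bundles using (HeytingAlgebra)
import Algebra.Properties.Group as GroupProperties
import Relation.Binary.Lattice.Properties.HeytingAlgebra as HeytingAlgebraProperties
import Relation.Binary.Lattice.Properties.MeetSemilattice as MeetSemilatticeProperties
import Relation.Binary.Lattice.Properties.JoinSemilattice as JoinSemilatticeProperties
import Relation.Binary.Lattice.Properties.DistributiveLattice as DistributiveLatticeProperties
import Relation.Binary.Reasoning.PartialOrder as ≤-Reasoning

module HeytingAlgebraExchange {c ℓ₁ ℓ₂} (H : HeytingAlgebra c ℓ₁ ℓ₂) where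

  open HeytingAlgebra H
  open HeytingAlgebraProperties H using (¬_)
  open MeetSemilatticeProperties meetSemilattice using (∧-comm; ∧-monotonic)
  open ≤-Reasoning poset

  ∧≤¬-exchange : ∀ {x y z} → x ∧ y ≤ ¬ z → x ∧ z ≤ ¬ y
  ∧≤¬-exchange {x} {y} {z} h = transpose-⇨ (begin
    (x ∧ z) ∧ y ≤⟨ ∧-greatest (∧-monotonic (x∧y≤x _ _) refl) (trans (x∧y≤x _ _) (x∧y≤y _ _)) ⟩
    (x ∧ y) ∧ z ≤⟨ transpose-∧ h ⟩
    ⊥           ∎)

  ∧≤¬-reverse : ∀ {x y z} → x ∧ y ≤ ¬ z → z ∧ y ≤ ¬ x
  ∧≤¬-reverse h = ∧-comm-≤ (∧≤¬-exchange (∧-comm-≤ h))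
    where
    ∧-comm-≤ : ∀ {x y t} → x ∧ y ≤ t → y ∧ x ≤ t
    ∧-comm-≤ = trans (reflexive (∧-comm _ _))

module CompleteHeytingAlgebraProperties {c ℓ₁ ℓ₂ ι} (L : CompleteHeytingAlgebra c ℓ₁ ℓ₂ ι) where

  open CompleteHeytingAlgebra L
  open HeytingAlgebraProperties heytingAlgebra using (⇨-eval; ∧-distribˡ-∨-≤; weak-lem)
  open MeetSemilatticeProperties meetSemilattice using (∧-comm)

  ⋁-∧-least : ∀ {I : Set ι} (f : I → Carrier) {x t} → (∀ i → f i ∧ x ≤ t) → ⋁ f ∧ x ≤ t
  ⋁-∧-least f {x} {t} h = transpose-∧ (⋁-least f (x ⇨ t) (λ i → transpose-⇨ (h i)))

  ∧-⋁-least : ∀ {I : Set ι} (f : I → Carrier) {x t} → (∀ i → x ∧ f i ≤ t) → x ∧ ⋁ f ≤ t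
  ∧-⋁-least f h = trans (reflexive (∧-comm _ _)) (⋁-∧-least f (λ i → trans (reflexive (∧-comm _ _)) (h i)))

  IsBoolean⇔¬¬-elim : IsBoolean L ⇔ (∀ x → ¬ ¬ x ≤ x)
  IsBoolean⇔¬¬-elim = mk⇔ ¬¬-elim excluded-middle
    where
    open ≤-Reasoning poset

    ¬¬-elim : IsBoolean L → ∀ x → ¬ ¬ x ≤ x
    ¬¬-elim x∨¬x≈⊤ x = begin
      ¬ ¬ x                       ≤⟨ ∧-greatest refl (trans (maximum _) (reflexive (Eq.sym (x∨¬x≈⊤ x)))) ⟩
      ¬ ¬ x ∧ (x ∨ ¬ x)           ≤⟨ ∧-distribˡ-∨-≤ _ _ _ ⟩
      (¬ ¬ x ∧ x) ∨ (¬ ¬ x ∧ ¬ x) ≤⟨ ∨-least (x∧y≤y _ _) (trans ⇨-eval (minimum _)) ⟩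
      x                           ∎

    excluded-middle : (∀ x → ¬ ¬ x ≤ x) → IsBoolean L
    excluded-middle ¬¬x≤x x = antisym (maximum _) (begin
      ⊤               ≈⟨ Eq.sym weak-lem ⟩
      ¬ ¬ (¬ x ∨ x)   ≤⟨ ¬¬x≤x _ ⟩
      ¬ x ∨ x         ≤⟨ ∨-least (y≤x∨y _ _) (x≤x∨y _ _) ⟩
      x ∨ ¬ x         ∎)

module FunctionAlgebraProperties {g gℓ c ℓ₁ ℓ₂} (G : Group g gℓ) (L : CompleteHeytingAlgebra c ℓ₁ ℓ₂ (g ⊔ gℓ)) where

  open FunctionAlgebra G L
  private
    module G = Group G
    module L = CompleteHeytingAlgebra L
  open G using (_∙_; _⁻¹; ε)
  open GroupProperties G using (⁻¹-involutive; ⁻¹-anti-homo-∙; \\-leftDividesʳ; //-rightDividesʳ)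
  open L using (_≤_; _∧_; ⊤; ¬_)
  open HeytingAlgebraProperties L.heytingAlgebra using (x≤¬¬x; ∧-distribˡ-∨-≤)
  open MeetSemilatticeProperties L.meetSemilattice using (∧-assoc; ∧-monotonic)
  open JoinSemilatticeProperties L.joinSemilattice using (∨-monotonic; x≤y⇒x∨y≈y)
  open DistributiveLatticeProperties (HeytingAlgebraProperties.distributiveLattice L.heytingAlgebra)
    using (∧-distribʳ-∨)
  open HeytingAlgebraExchange L.heytingAlgebra
  open CompleteHeytingAlgebraProperties L using (⋁-∧-least; ∧-⋁-least)
  open ≤-Reasoning L.poset

  ⊑-refl : ∀ {α} → α ⊑ α
  ⊑-refl _ = L.refl

  ⊑-trans : ∀ {α β γ} → α ⊑ β → β ⊑ γ → α ⊑ γ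
  ⊑-trans α⊑β β⊑γ x = L.trans (α⊑β x) (β⊑γ x)

  ⊑-antisym : ∀ {α β} → α ⊑ β → β ⊑ α → α ≐ β
  ⊑-antisym α⊑β β⊑α x = L.antisym (α⊑β x) (β⊑α x)

  Respects⇒⌣⌣⊒ : ∀ {α} → Respects α → α ⊑ α ⌣ ⌣
  Respects⇒⌣⌣⊒ Rα x = L.reflexive (Rα (G.sym (⁻¹-involutive x)))

  ⨾-upper : ∀ α β {x y z} → x ∙ y G.≈ z → α x ∧ β y ≤ (α ⨾ β) z
  ⨾-upper α β {x} {y} xy≈z = L.⋁-upper _ ((x , y) , xy≈z)

  ⨾-least : ∀ α β z {t} → (∀ {x y} → x ∙ y G.≈ z → α x ∧ β y ≤ t) → (α ⨾ β) z ≤ t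
  ⨾-least α β z {t} h = L.⋁-least _ t (λ { ((x , y) , xy≈z) → h xy≈z })

  ⨾⊑⇔ : ∀ {α β γ} → α ⨾ β ⊑ γ ⇔ (∀ {x y z} → x ∙ y G.≈ z → α x ∧ β y ≤ γ z)
  ⨾⊑⇔ {α} {β} {γ} = mk⇔ (λ h {_} {_} {z} xy≈z → L.trans (⨾-upper α β xy≈z) (h z))
                          (λ h z → ⨾-least α β z h)

  ⨾-mono : ∀ {α α′ β β′} → α ⊑ α′ → β ⊑ β′ → α ⨾ β ⊑ α′ ⨾ β′
  ⨾-mono {α} {α′} {β} {β′} α⊑α′ β⊑β′ = Equivalence.from ⨾⊑⇔ λ xy≈z →
    L.trans (∧-monotonic (α⊑α′ _) (β⊑β′ _)) (⨾-upper α′ β′ xy≈z)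

  ⨾-assoc : ∀ α β γ → α ⨾ (β ⨾ γ) ≐ (α ⨾ β) ⨾ γ
  ⨾-assoc α β γ = ⊑-antisym
    (Equivalence.from ⨾⊑⇔ λ {x} {w} {z} xw≈z → ∧-⋁-least _ λ { ((u , v) , uv≈w) → begin
      α x ∧ β u ∧ γ v       ≈⟨ L.Eq.sym (∧-assoc _ _ _) ⟩
      (α x ∧ β u) ∧ γ v     ≤⟨ ∧-monotonic (⨾-upper α β G.refl) L.refl ⟩
      (α ⨾ β) (x ∙ u) ∧ γ v ≤⟨ ⨾-upper (α ⨾ β) γ (G.trans (G.assoc x u v) (G.trans (G.∙-congˡ uv≈w) xw≈z)) ⟩
      ((α ⨾ β) ⨾ γ) z       ∎ })
    (Equivalence.from ⨾⊑⇔ λ {w} {v} {z} wv≈z → ⋁-∧-least _ λ { ((x , u) , xu≈w) → begin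
      (α x ∧ β u) ∧ γ v     ≈⟨ ∧-assoc _ _ _ ⟩
      α x ∧ β u ∧ γ v       ≤⟨ ∧-monotonic L.refl (⨾-upper β γ G.refl) ⟩
      α x ∧ (β ⨾ γ) (u ∙ v) ≤⟨ ⨾-upper α (β ⨾ γ) (G.trans (G.sym (G.assoc x u v)) (G.trans (G.∙-congʳ xu≈w) wv≈z)) ⟩
      (α ⨾ (β ⨾ γ)) z       ∎ })

  ⊤≤1′ε : ⊤ ≤ 1′ ε
  ⊤≤1′ε = L.⋁-upper _ (lift G.refl)

  ⨾-identityʳ : ∀ {α} → Respects α → α ⨾ 1′ ≐ α
  ⨾-identityʳ {α} Rα = ⊑-antisym
    (Equivalence.from ⨾⊑⇔ λ {x} {y} xy≈z → ∧-⋁-least _ λ { (lift y≈ε) →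
      L.trans (L.x∧y≤x _ _)
              (L.reflexive (Rα (G.trans (G.sym (G.identityʳ x)) (G.trans (G.∙-congˡ (G.sym y≈ε)) xy≈z)))) })
    (λ z → L.trans (L.∧-greatest L.refl (L.trans (L.maximum _) ⊤≤1′ε)) (⨾-upper α 1′ (G.identityʳ z)))

  ⨾-identityˡ : ∀ {α} → Respects α → 1′ ⨾ α ≐ α
  ⨾-identityˡ {α} Rα = ⊑-antisym
    (Equivalence.from ⨾⊑⇔ λ {x} {y} xy≈z → ⋁-∧-least _ λ { (lift x≈ε) →
      L.trans (L.x∧y≤y _ _)
              (L.reflexive (Rα (G.trans (G.sym (G.identityˡ y)) (G.trans (G.∙-congʳ (G.sym x≈ε)) xy≈z)))) })
    (λ z → L.trans (L.∧-greatest (L.trans (L.maximum _) ⊤≤1′ε) L.refl) (⨾-upper 1′ α (G.identityˡ z)))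

  ⨾-distribʳ-∨ᶠ : ∀ α β γ → (α ∨ᶠ β) ⨾ γ ≐ (α ⨾ γ) ∨ᶠ (β ⨾ γ)
  ⨾-distribʳ-∨ᶠ α β γ = ⊑-antisym
    (Equivalence.from ⨾⊑⇔ λ xy≈z → L.trans (L.reflexive (∧-distribʳ-∨ _ _ _))
      (∨-monotonic (⨾-upper α γ xy≈z) (⨾-upper β γ xy≈z)))
    (λ z → L.∨-least (⨾-mono (λ _ → L.x≤x∨y _ _) ⊑-refl z) (⨾-mono (λ _ → L.y≤x∨y _ _) ⊑-refl z))

  ⨾-distribˡ-∨ᶠ : ∀ α β γ → α ⨾ (β ∨ᶠ γ) ≐ (α ⨾ β) ∨ᶠ (α ⨾ γ)
  ⨾-distribˡ-∨ᶠ α β γ = ⊑-antisym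
    (Equivalence.from ⨾⊑⇔ λ xy≈z → L.trans (∧-distribˡ-∨-≤ _ _ _)
      (∨-monotonic (⨾-upper α β xy≈z) (⨾-upper α γ xy≈z)))
    (λ z → L.∨-least (⨾-mono ⊑-refl (λ _ → L.x≤x∨y _ _) z) (⨾-mono ⊑-refl (λ _ → L.y≤x∨y _ _) z))

  ⌣-involutive : ∀ {α} → Respects α → α ⌣ ⌣ ≐ α
  ⌣-involutive Rα x = Rα (⁻¹-involutive x)

  ⌣-distrib-∨ᶠ : ∀ α β → (α ∨ᶠ β) ⌣ ≐ α ⌣ ∨ᶠ β ⌣
  ⌣-distrib-∨ᶠ α β x = L.Eq.refl

  ⌣-anti-⨾ : ∀ {α β} → Respects α → Respects β → (α ⨾ β) ⌣ ≐ β ⌣ ⨾ α ⌣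
  ⌣-anti-⨾ {α} {β} Rα Rβ = ⊑-antisym
    (λ z → ⨾-least α β (z ⁻¹) λ {x} {y} xy≈z⁻¹ → begin
      α x ∧ β y                   ≤⟨ L.∧-greatest (L.trans (L.x∧y≤y _ _) (Respects⇒⌣⌣⊒ Rβ y))
                                                  (L.trans (L.x∧y≤x _ _) (Respects⇒⌣⌣⊒ Rα x)) ⟩
      (β ⌣) (y ⁻¹) ∧ (α ⌣) (x ⁻¹) ≤⟨ ⨾-upper (β ⌣) (α ⌣) (G.trans (G.sym (⁻¹-anti-homo-∙ x y))
                                        (G.trans (G.⁻¹-cong xy≈z⁻¹) (⁻¹-involutive z))) ⟩
      (β ⌣ ⨾ α ⌣) z               ∎)
    (Equivalence.from ⨾⊑⇔ λ {u} {v} uv≈z →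
      L.trans (L.∧-greatest (L.x∧y≤y _ _) (L.x∧y≤x _ _))
              (⨾-upper α β (G.trans (G.sym (⁻¹-anti-homo-∙ u v)) (G.⁻¹-cong uv≈z))))

  ⨾⊑¬-rotateˡ : ∀ {α β γ} → α ⨾ β ⊑ ¬ᶠ γ → α ⌣ ⨾ γ ⊑ ¬ᶠ β
  ⨾⊑¬-rotateˡ α⨾β⊑¬γ = Equivalence.from ⨾⊑⇔ λ {u} {v} uv≈w →
    ∧≤¬-exchange (Equivalence.to ⨾⊑⇔ α⨾β⊑¬γ (G.trans (G.∙-congˡ (G.sym uv≈w)) (\\-leftDividesʳ u v)))

  ⨾⊑¬-rotateʳ : ∀ {α β γ} → α ⨾ β ⊑ ¬ᶠ γ → γ ⨾ β ⌣ ⊑ ¬ᶠ α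
  ⨾⊑¬-rotateʳ α⨾β⊑¬γ = Equivalence.from ⨾⊑⇔ λ {u} {v} uv≈w →
    ∧≤¬-reverse (Equivalence.to ⨾⊑⇔ α⨾β⊑¬γ (G.trans (G.∙-congʳ (G.sym uv≈w)) (//-rightDividesʳ v u)))

  cycle-law : ∀ {α β γ} → Respects α → Respects β →
              (α ⨾ β ⊑ ¬ᶠ γ ⇔ α ⌣ ⨾ γ ⊑ ¬ᶠ β) × (α ⌣ ⨾ γ ⊑ ¬ᶠ β ⇔ γ ⨾ β ⌣ ⊑ ¬ᶠ α)
  cycle-law {α} {β} {γ} Rα Rβ =
    mk⇔ ⨾⊑¬-rotateˡ unrotateˡ , mk⇔ (⨾⊑¬-rotateʳ ∘ unrotateˡ) (⨾⊑¬-rotateˡ ∘ unrotateʳ)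
    where
    unrotateˡ : α ⌣ ⨾ γ ⊑ ¬ᶠ β → α ⨾ β ⊑ ¬ᶠ γ
    unrotateˡ h = ⊑-trans (⨾-mono (Respects⇒⌣⌣⊒ Rα) ⊑-refl) (⨾⊑¬-rotateˡ h)

    unrotateʳ : γ ⨾ β ⌣ ⊑ ¬ᶠ α → α ⨾ β ⊑ ¬ᶠ γ
    unrotateʳ h = ⊑-trans (⨾-mono ⊑-refl (Respects⇒⌣⌣⊒ Rβ)) (⨾⊑¬-rotateʳ h)

  ⌣⨾¬⨾⊑¬ : ∀ α β → α ⌣ ⨾ ¬ᶠ (α ⨾ β) ⊑ ¬ᶠ β
  ⌣⨾¬⨾⊑¬ α β = ⨾⊑¬-rotateˡ (λ z → x≤¬¬x _)

  ⊑⇒∨ᶠ≐ : ∀ {α β} → α ⊑ β → α ∨ᶠ β ≐ β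
  ⊑⇒∨ᶠ≐ α⊑β x = x≤y⇒x∨y≈y (α⊑β x)

  BooleanCycleLaw : Set (g ⊔ gℓ ⊔ c ⊔ ℓ₁ ⊔ ℓ₂)
  BooleanCycleLaw = ∀ a b c → Respects a → Respects b → Respects c →
                      (a ⨾ b ⊑ c ⇔ a ⌣ ⨾ ¬ᶠ c ⊑ ¬ᶠ b) × (a ⌣ ⨾ ¬ᶠ c ⊑ ¬ᶠ b ⇔ ¬ᶠ c ⨾ b ⌣ ⊑ ¬ᶠ a)

  BooleanCycleLaw⇔¬¬-elim : BooleanCycleLaw ⇔ (∀ x → ¬ ¬ x ≤ x)
  BooleanCycleLaw⇔¬¬-elim = mk⇔ ¬¬-elim boolean-cycle-law
    where
    constant-respects : ∀ v → Respects (const v)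
    constant-respects v _ = L.Eq.refl

    ¬¬-elim : BooleanCycleLaw → ∀ x → ¬ ¬ x ≤ x
    ¬¬-elim law x = begin
      ¬ ¬ x     ≤⟨ L.∧-greatest (L.maximum _) L.refl ⟩
      ⊤ ∧ ¬ ¬ x ≤⟨ ⨾-upper a b (G.identityˡ ε) ⟩
      (a ⨾ b) ε ≤⟨ a⨾b⊑c ε ⟩
      x         ∎
      where
      a = const ⊤
      b = const (¬ ¬ x)
      Ra = constant-respects ⊤
      Rb = constant-respects (¬ ¬ x)
      Rc = constant-respects x
      a⨾b⊑¬¬c : a ⨾ b ⊑ ¬ᶠ ¬ᶠ const x
      a⨾b⊑¬¬c z = ⨾-least a b z (λ _ → L.x∧y≤y _ _)
      a⨾b⊑c : a ⨾ b ⊑ const x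
      a⨾b⊑c = Equivalence.from (proj₁ (law a b (const x) Ra Rb Rc))
                (Equivalence.to (proj₁ (cycle-law Ra Rb)) a⨾b⊑¬¬c)

    boolean-cycle-law : (∀ x → ¬ ¬ x ≤ x) → BooleanCycleLaw
    boolean-cycle-law ¬¬x≤x a b c Ra Rb _ =
        proj₁ (cycle-law Ra Rb) ⇔-∘ mk⇔ (λ h z → L.trans (h z) (x≤¬¬x _)) (λ h z → L.trans (h z) (¬¬x≤x _))
      , proj₂ (cycle-law Ra Rb)

proposition6p8 : ∀ {g gℓ c ℓ₁ ℓ₂} (G : Group g gℓ) (L : CompleteHeytingAlgebra c ℓ₁ ℓ₂ (g ⊔ gℓ)) →
    let open FunctionAlgebra G L in
      (∀ a b c → Respects a → Respects b → Respects c →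
           (a ⨾ (b ⨾ c) ≐ (a ⨾ b) ⨾ c)
         × ((a ⨾ 1′ ≐ a) × (1′ ⨾ a ≐ a))
         × (((a ∨ᶠ b) ⨾ c ≐ (a ⨾ c) ∨ᶠ (b ⨾ c)) × (a ⨾ (b ∨ᶠ c) ≐ (a ⨾ b) ∨ᶠ (a ⨾ c)))
         × ((a ⌣) ⌣ ≐ a)
         × ((a ∨ᶠ b) ⌣ ≐ (a ⌣) ∨ᶠ (b ⌣))
         × ((a ⨾ b) ⌣ ≐ (b ⌣) ⨾ (a ⌣))
         × (((a ⌣) ⨾ (¬ᶠ (a ⨾ b))) ∨ᶠ (¬ᶠ b) ≐ ¬ᶠ b)
         × (((a ⨾ b ⊑ ¬ᶠ (¬ᶠ c)) ⇔ ((a ⌣) ⨾ (¬ᶠ c) ⊑ ¬ᶠ b))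
           × (((a ⌣) ⨾ (¬ᶠ c) ⊑ ¬ᶠ b) ⇔ ((¬ᶠ c) ⨾ (b ⌣) ⊑ ¬ᶠ a))))
      × ((∀ a b c → Respects a → Respects b → Respects c →
            ((a ⨾ b ⊑ c) ⇔ ((a ⌣) ⨾ (¬ᶠ c) ⊑ ¬ᶠ b))
          × (((a ⌣) ⨾ (¬ᶠ c) ⊑ ¬ᶠ b) ⇔ ((¬ᶠ c) ⨾ (b ⌣) ⊑ ¬ᶠ a)))
        ⇔ IsBoolean L)
proposition6p8 G L =
    (λ a b c Ra Rb Rc →
        ⨾-assoc a b c
      , (⨾-identityʳ Ra , ⨾-identityˡ Ra)
      , (⨾-distribʳ-∨ᶠ a b c , ⨾-distribˡ-∨ᶠ a b c)
      , ⌣-involutive Ra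
      , ⌣-distrib-∨ᶠ a b
      , ⌣-anti-⨾ Ra Rb
      , ⊑⇒∨ᶠ≐ (⌣⨾¬⨾⊑¬ a b)
      , cycle-law Ra Rb)
  , ⇔-sym (IsBoolean⇔¬¬-elim L) ⇔-∘ BooleanCycleLaw⇔¬¬-elim
  where
  open FunctionAlgebraProperties G L
  open CompleteHeytingAlgebraProperties using (IsBoolean⇔¬¬-elim)
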